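{- Work in the "linear" axiomatic framework for three-dimensional projective space described in the context. If statement [H$_{\mathrm{pl}}$] holds, then statement [H$_{\mathrm{pt}}$] holds, where: [H$_{\mathrm{pl}}$]: for every plane-tetrad $o,p,q,r$, its diagonals $a,b,c$ (the unique lines with $a\in\mathrm{pt}(o,p)\cap\mathrm{pt}(q,r)$, $b\in\mathrm{pt}(o,q)\cap\mathrm{pt}(r,p)$, $c\in\mathrm{pt}(o,r)\cap\mathrm{pt}(p,q)$) form a plane-triad; [H$_{\mathrm{pt}}$]: for every point-tetrad $o,p,q,r$, its diagonals $a,b,c$ (the unique lines with $a\in\mathrm{pl}(o,p)\cap\mathrm{pl}(q,r)$, $b\in\mathrm{pl}(o,q)\cap\mathrm{pl}(r,p)$, $c\in\mathrm{pl}(o,r)\cap\mathrm{pl}(p,q)$) form a point-triad.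
   Context: Let $\mathbb{L}$ be a set (whose elements are called lines) with a symmetric reflexive relation $\sim$ (incidence). Lines that are not incident are called skew. For $S \subseteq \mathbb{L}$ let $S^{\sim}$ be the set of all lines incident to every line of $S$, and write $[l_1 \dots l_n] = \{l_1,\dots,l_n\}^{\sim}$. The axioms are: Axiom [1]: for each line $l$, the set $\{l\}^{\sim}$ contains three pairwise skew lines. Axiom [2]: for each incident pair of distinct lines $a,b$: (2.1) $[ab]$ contains skew pairs of lines; (2.2) if $c \in [ab]\setminus[ab]^{\sim}$ is one of such a skew pair, then no skew pairs lie in $[abc]$; (2.3) if $x,y$ is a skew pair in $[ab]$ then $[ab] = [abx]\cup[aby]$. Axiom [3]: if $a,b$ is an incident line pair and $c \in [ab]\setminus[ab]^{\sim}$, then there exist an incident line pair $p,q$ and $r \in [pq]\setminus[pq]^{\sim}$ with $[abc]\cap[pqr]=\emptyset$. For incident distinct lines $a,b$ put $\Sigma(a,b) = [ab]\setminus[ab]^{\sim}$; incidence restricted to $\Sigma(a,b)$ is an equivalence relation with exactly two classes, which (as part of the structure) are labelled $\Sigma_{\mathrm{pt}}(a,b)$ and $\Sigma_{\mathrm{pl}}(a,b)$. The point $\mathrm{pt}(a,b) = [abc]$ with $c \in \Sigma_{\mathrm{pt}}(a,b)$ and the plane $\mathrm{pl}(a,b) = [abc]$ with $c \in \Sigma_{\mathrm{pl}}(a,b)$ are independent of the choice of $c$. Axiom [4]: whenever $a,b$ and $p,q$ are pairs of distinct incident lines, $\mathrm{pt}(a,b)\cap\mathrm{pt}(p,q)\neq\emptyset$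 and $\mathrm{pl}(a,b)\cap\mathrm{pl}(p,q)\neq\emptyset$. A triad is a triple of pairwise-incident lines $a,b,c$ with $c \in \Sigma(a,b)$ (equivalently $a\in\Sigma(b,c)$, equivalently $b \in \Sigma(c,a)$). It is a plane-triad if $a\in\Sigma_{\mathrm{pl}}(b,c)$, $b\in\Sigma_{\mathrm{pl}}(c,a)$, $c\in\Sigma_{\mathrm{pl}}(a,b)$, and a point-triad if the same holds with $\mathrm{pt}$ in place of $\mathrm{pl}$. A plane-tetrad (resp. point-tetrad) is a set $\{o,p,q,r\}$ of four pairwise-incident lines such that each of the triples $\{p,q,r\},\{o,q,r\},\{o,r,p\},\{o,p,q\}$ is a plane-triad (resp. point-triad). For a tetrad, each of the six intersections used to define its diagonals consists of exactly one line. -}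

module Defs where

open import Data.Product using (Σ; ∃; ∃-syntax; _×_; _,_)
open import Data.Sum using (_⊎_)
open import Relation.Nullary using (¬_)
open import Relation.Binary.PropositionalEquality using (_≡_)

record LinearSpace : Set₁ where
  field
    Line : Set
    _∼_  : Line → Line → Set
    ∼-refl : ∀ l → l ∼ l
    ∼-sym  : ∀ {l m} → l ∼ m → m ∼ l

  Skew : Line → Line → Set
  Skew x y = ¬ (x ∼ y)

  ⟦_⟧ : Line → Line → Set
  ⟦ l ⟧ x = l ∼ x

  ⟦_∣_⟧ : Line → Line → Line → Set
  ⟦ l₁ ∣ l₂ ⟧ x = l₁ ∼ x × l₂ ∼ x

  ⟦_∣_∣_⟧ : Line → Line → Line → Line → Set
  ⟦ l₁ ∣ l₂ ∣ l₃ ⟧ x = l₁ ∼ x × l₂ ∼ x × l₃ ∼ x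

  ⟦_∣_⟧∼ : Line → Line → Line → Set
  ⟦ a ∣ b ⟧∼ x = ∀ y → ⟦ a ∣ b ⟧ y → x ∼ y

  Σ⟪_∣_⟫ : Line → Line → Line → Set
  Σ⟪ a ∣ b ⟫ c = ⟦ a ∣ b ⟧ c × ¬ (⟦ a ∣ b ⟧∼ c)

  IncDist : Line → Line → Set
  IncDist a b = a ∼ b × ¬ (a ≡ b)

  field
    axiom1  : ∀ l → ∃[ x ] ∃[ y ] ∃[ z ]
                (⟦ l ⟧ x × ⟦ l ⟧ y × ⟦ l ⟧ z × Skew x y × Skew y z × Skew x z)
    axiom21 : ∀ a b → IncDist a b →
                ∃[ x ] ∃[ y ] (⟦ a ∣ b ⟧ x × ⟦ a ∣ b ⟧ y × Skew x y)
    axiom22 : ∀ a b → IncDist a b → ∀ c → Σ⟪ a ∣ b ⟫ c →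
                (∃[ d ] (⟦ a ∣ b ⟧ d × Skew c d)) →
                ∀ x y → ⟦ a ∣ b ∣ c ⟧ x → ⟦ a ∣ b ∣ c ⟧ y → x ∼ y
    axiom23 : ∀ a b → IncDist a b → ∀ x y → ⟦ a ∣ b ⟧ x → ⟦ a ∣ b ⟧ y → Skew x y →
                ∀ z → (⟦ a ∣ b ⟧ z → ⟦ a ∣ b ∣ x ⟧ z ⊎ ⟦ a ∣ b ∣ y ⟧ z)
                    × (⟦ a ∣ b ∣ x ⟧ z ⊎ ⟦ a ∣ b ∣ y ⟧ z → ⟦ a ∣ b ⟧ z)
    axiom3  : ∀ a b → IncDist a b → ∀ c → Σ⟪ a ∣ b ⟫ c →
                ∃[ p ] ∃[ q ] ∃[ r ] (IncDist p q × Σ⟪ p ∣ q ⟫ r ×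
                  (∀ x → ¬ (⟦ a ∣ b ∣ c ⟧ x × ⟦ p ∣ q ∣ r ⟧ x)))

    Σpt Σpl : Line → Line → Line → Set
    Σpt⊆Σ  : ∀ a b → IncDist a b → ∀ c → Σpt a b c → Σ⟪ a ∣ b ⟫ c
    Σpl⊆Σ  : ∀ a b → IncDist a b → ∀ c → Σpl a b c → Σ⟪ a ∣ b ⟫ c
    Σ⊆pt∪pl : ∀ a b → IncDist a b → ∀ c → Σ⟪ a ∣ b ⟫ c → Σpt a b c ⊎ Σpl a b c
    Σpt-ne : ∀ a b → IncDist a b → ∃[ c ] Σpt a b c
    Σpl-ne : ∀ a b → IncDist a b → ∃[ c ] Σpl a b c
    Σpt-class : ∀ a b → IncDist a b → ∀ x y → Σpt a b x → Σpt a b y → x ∼ y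
    Σpl-class : ∀ a b → IncDist a b → ∀ x y → Σpl a b x → Σpl a b y → x ∼ y
    Σpt-pl-skew : ∀ a b → IncDist a b → ∀ x y → Σpt a b x → Σpl a b y → Skew x y

  pt : Line → Line → Line → Set
  pt a b x = ∃[ c ] (Σpt a b c × ⟦ a ∣ b ∣ c ⟧ x)

  pl : Line → Line → Line → Set
  pl a b x = ∃[ c ] (Σpl a b c × ⟦ a ∣ b ∣ c ⟧ x)

  field
    axiom4 : ∀ a b p q → IncDist a b → IncDist p q →
               (∃[ x ] (pt a b x × pt p q x)) × (∃[ x ] (pl a b x × pl p q x))

  Triad : Line → Line → Line → Set
  Triad a b c = IncDist a b × IncDist b c × IncDist c a × Σ⟪ a ∣ b ⟫ c

  PlaneTriad : Line → Line → Line → Set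
  PlaneTriad a b c = Triad a b c × Σpl b c a × Σpl c a b × Σpl a b c

  PointTriad : Line → Line → Line → Set
  PointTriad a b c = Triad a b c × Σpt b c a × Σpt c a b × Σpt a b c

  PlaneTetrad : Line → Line → Line → Line → Set
  PlaneTetrad o p q r =
    o ∼ p × o ∼ q × o ∼ r × p ∼ q × p ∼ r × q ∼ r ×
    PlaneTriad p q r × PlaneTriad o q r × PlaneTriad o r p × PlaneTriad o p q

  PointTetrad : Line → Line → Line → Line → Set
  PointTetrad o p q r =
    o ∼ p × o ∼ q × o ∼ r × p ∼ q × p ∼ r × q ∼ r ×
    PointTriad p q r × PointTriad o q r × PointTriad o r p × PointTriad o p q

  Hpl : Set
  Hpl = ∀ o p q r → PlaneTetrad o p q r → ∀ a b c →
          pt o p a → pt q r a → pt o q b → pt r p b → pt o r c → pt p q c →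
          PlaneTriad a b c

  Hpt : Set
  Hpt = ∀ o p q r → PointTetrad o p q r → ∀ a b c →
          pl o p a → pl q r a → pl o q b → pl r p b → pl o r c → pl p q c →
          PointTriad a b c

-- All lines of the tetrad and its diagonals lie in the point P = pt(o,p), which
-- equals pt(a,b).  By rotating the tetrad it suffices to show c ∈ Σpt(a,b), and as
-- c ∈ pt(a,b) this amounts to c ∉ [ab]^∼.  Suppose c ∈ [ab]^∼ and cut everything
-- by a plane Π avoiding P (axioms [3] and [4]).  The traces on Π of the planes
-- pl(o,p), pl(p,q), pl(q,r), pl(o,r) form a plane-tetrad; its diagonals are the
-- traces of pl(r,p), pl(o,q) and pl(a,b) (the latter passes through the trace of
-- c exactly because c ∈ [ab]^∼), so by [H_pl] they form a plane-triad.  But the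
-- traces of pl(r,p), pl(a,b) and pl(o,q) all pass through the trace of b, making
-- the third one lie in Σpt instead of Σpl of the other two.
module Submission where

open import Defs
open import Data.Product using (∃-syntax; _×_; _,_; proj₁; proj₂)
open import Data.Sum using (_⊎_; inj₁; inj₂)
open import Data.Empty using (⊥; ⊥-elim)
open import Relation.Nullary using (¬_)
open import Relation.Unary using (_⊆_; _≐_)
open import Relation.Binary.PropositionalEquality using (_≡_; _≢_; sym; subst; ≢-sym)

data Kind : Set where
  point plane : Kind

dual : Kind → Kind
dual point = plane
dual plane = point

module Flats (S : LinearSpace) where
  open LinearSpace S

  IncDist-sym : ∀ {a b} → IncDist a b → IncDist b a
  IncDist-sym (a∼b , a≢b) = ∼-sym a∼b , ≢-sym a≢b

  Σ-swap : ∀ {a b c} → Σ⟪ a ∣ b ⟫ c → Σ⟪ b ∣ a ⟫ c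
  Σ-swap ((a∼c , b∼c) , ¬central) =
    (b∼c , a∼c) , λ central → ¬central (λ y (a∼y , b∼y) → central y (b∼y , a∼y))

  ≢-of-skew : ∀ {x y w} → x ∼ w → Skew y w → x ≢ y
  ≢-of-skew x∼w y≁w x≡y = y≁w (subst (_∼ _) x≡y x∼w)

  ¬central-of-skew : ∀ {x y z w} → x ∼ w → y ∼ w → Skew z w → ¬ ⟦ x ∣ y ⟧∼ z
  ¬central-of-skew x∼w y∼w z≁w central = z≁w (central _ (x∼w , y∼w))

  Class : Kind → Line → Line → Line → Set
  Class point = Σpt
  Class plane = Σpl

  -- Flat point = pt and Flat plane = pl definitionally.
  Flat : Kind → Line → Line → Line → Set
  Flat k a b x = ∃[ c ] (Class k a b c × ⟦ a ∣ b ∣ c ⟧ x)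

  Class⊆Σ : ∀ k {a b} → IncDist a b → ∀ {c} → Class k a b c → Σ⟪ a ∣ b ⟫ c
  Class⊆Σ point d s = Σpt⊆Σ _ _ d _ s
  Class⊆Σ plane d s = Σpl⊆Σ _ _ d _ s

  Class-incident : ∀ k {a b} → IncDist a b → ∀ {c} → Class k a b c → ⟦ a ∣ b ⟧ c
  Class-incident k d s = proj₁ (Class⊆Σ k d s)

  Class-nonempty : ∀ k {a b} → IncDist a b → ∃[ c ] Class k a b c
  Class-nonempty point d = Σpt-ne _ _ d
  Class-nonempty plane d = Σpl-ne _ _ d

  Class-clique : ∀ k {a b} → IncDist a b → ∀ {x y} → Class k a b x → Class k a b y → x ∼ y
  Class-clique point d sx sy = Σpt-class _ _ d _ _ sx sy
  Class-clique plane d sx sy = Σpl-class _ _ d _ _ sx sy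

  Class-skew-dual : ∀ k {a b} → IncDist a b → ∀ {x y} →
                    Class k a b x → Class (dual k) a b y → Skew x y
  Class-skew-dual point d sx sy = Σpt-pl-skew _ _ d _ _ sx sy
  Class-skew-dual plane d sx sy x∼y = Σpt-pl-skew _ _ d _ _ sy sx (∼-sym x∼y)

  Σ⊆Class∪dual : ∀ k {a b} → IncDist a b → ∀ {c} →
                 Σ⟪ a ∣ b ⟫ c → Class k a b c ⊎ Class (dual k) a b c
  Σ⊆Class∪dual point d σ = Σ⊆pt∪pl _ _ d _ σ
  Σ⊆Class∪dual plane d σ with Σ⊆pt∪pl _ _ d _ σ
  ... | inj₁ s = inj₂ s
  ... | inj₂ s = inj₁ s

  Flats-meet : ∀ k {a b p q} → IncDist a b → IncDist p q → ∃[ x ] (Flat k a b x × Flat k p q x)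
  Flats-meet point d e = proj₁ (axiom4 _ _ _ _ d e)
  Flats-meet plane d e = proj₂ (axiom4 _ _ _ _ d e)

  Flat⇒left∼ : ∀ k {a b x} → Flat k a b x → a ∼ x
  Flat⇒left∼ k (_ , _ , a∼x , _) = a∼x

  Flat⇒right∼ : ∀ k {a b x} → Flat k a b x → b ∼ x
  Flat⇒right∼ k (_ , _ , _ , b∼x , _) = b∼x

  ⟦∣∣⟧⊆Flat : ∀ k {a b c} → Class k a b c → ⟦ a ∣ b ∣ c ⟧ ⊆ Flat k a b
  ⟦∣∣⟧⊆Flat k {c = c} s h = c , s , h

  Class⊆Flat : ∀ k {a b} → IncDist a b → ∀ {c} → Class k a b c → Flat k a b c
  Class⊆Flat k d {c} s with Class-incident k d s
  ... | a∼c , b∼c = ⟦∣∣⟧⊆Flat k s (a∼c , b∼c , ∼-refl c)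

  left∈Flat : ∀ k {a b} → IncDist a b → Flat k a b a
  left∈Flat k {a} d@(a∼b , _) with Class-nonempty k d
  ... | c , s = ⟦∣∣⟧⊆Flat k s (∼-refl a , ∼-sym a∼b , ∼-sym (proj₁ (Class-incident k d s)))

  right∈Flat : ∀ k {a b} → IncDist a b → Flat k a b b
  right∈Flat k {b = b} d@(a∼b , _) with Class-nonempty k d
  ... | c , s = ⟦∣∣⟧⊆Flat k s (a∼b , ∼-refl b , ∼-sym (proj₂ (Class-incident k d s)))

  -- Axiom [2.2], with a skew partner of c taken from the other class.
  ⟦∣∣⟧-clique : ∀ k {a b} → IncDist a b → ∀ {c} → Class k a b c → ∀ {x y} →
                ⟦ a ∣ b ∣ c ⟧ x → ⟦ a ∣ b ∣ c ⟧ y → x ∼ y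
  ⟦∣∣⟧-clique k d s hx hy with Class-nonempty (dual k) d
  ... | e , se = axiom22 _ _ d _ (Class⊆Σ k d s)
                   (e , Class-incident (dual k) d se , Class-skew-dual k d s se) _ _ hx hy

  Flat⊆⟦∣∣⟧ : ∀ k {a b} → IncDist a b → ∀ {c} → Class k a b c → Flat k a b ⊆ ⟦ a ∣ b ∣ c ⟧
  Flat⊆⟦∣∣⟧ k d s (_ , s' , hx@(a∼x , b∼x , _)) with Class-incident k d s
  ... | a∼c , b∼c = a∼x , b∼x , ⟦∣∣⟧-clique k d s' (a∼c , b∼c , Class-clique k d s' s) hx

  Flat-clique : ∀ k {a b} → IncDist a b → ∀ {x y} → Flat k a b x → Flat k a b y → x ∼ y
  Flat-clique k d (_ , s , hx) fy = ⟦∣∣⟧-clique k d s hx (Flat⊆⟦∣∣⟧ k d s fy)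

  ⟦∣⟧⊆Flat∪dual : ∀ k {a b} → IncDist a b → ∀ {x} →
                  ⟦ a ∣ b ⟧ x → Flat k a b x ⊎ Flat (dual k) a b x
  ⟦∣⟧⊆Flat∪dual k d {x} h with Class-nonempty k d | Class-nonempty (dual k) d
  ... | u , su | v , sv
      with proj₁ (axiom23 _ _ d u v (Class-incident k d su) (Class-incident (dual k) d sv)
                            (Class-skew-dual k d su sv) x) h
  ... | inj₁ hu = inj₁ (⟦∣∣⟧⊆Flat k su hu)
  ... | inj₂ hv = inj₂ (⟦∣∣⟧⊆Flat (dual k) sv hv)

  Flat∩dual⊆central : ∀ k {a b} → IncDist a b → ∀ {c} →
                   Flat k a b c → Flat (dual k) a b c → ⟦ a ∣ b ⟧∼ c
  Flat∩dual⊆central k d fc gc y h with ⟦∣⟧⊆Flat∪dual k d h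
  ... | inj₁ fy = Flat-clique k d fc fy
  ... | inj₂ gy = Flat-clique (dual k) d gc gy

  dual-Class-∉Flat : ∀ k {a b} → IncDist a b → ∀ {z} → Class (dual k) a b z → ¬ Flat k a b z
  dual-Class-∉Flat k d sz (e , se , _ , _ , e∼z) = Class-skew-dual k d se sz e∼z

  central⊆Flat : ∀ k {a b} → IncDist a b → ∀ {w} → ⟦ a ∣ b ⟧ w → ⟦ a ∣ b ⟧∼ w → Flat k a b w
  central⊆Flat k d (a∼w , b∼w) central with Class-nonempty k d
  ... | e , se = ⟦∣∣⟧⊆Flat k se (a∼w , b∼w , ∼-sym (central e (Class-incident k d se)))

  ∉Flat⇒dual-Class : ∀ k {a b} → IncDist a b → ∀ {w} →
                     ⟦ a ∣ b ⟧ w → ¬ Flat k a b w → Class (dual k) a b w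
  ∉Flat⇒dual-Class k d h w∉ with Σ⊆Class∪dual k d (h , λ central → w∉ (central⊆Flat k d h central))
  ... | inj₁ sw = ⊥-elim (w∉ (Class⊆Flat k d sw))
  ... | inj₂ sw = sw

  dual-Flat-avoiding : ∀ k {a b} → IncDist a b →
    ∃[ u ] ∃[ v ] (IncDist u v × (∀ x → Flat (dual k) u v x → ¬ Flat k a b x))
  dual-Flat-avoiding k dab with Class-nonempty k dab
  ... | c , s with axiom3 _ _ dab c (Class⊆Σ k dab s)
  ... | u , v , r , duv , σ , disjoint = u , v , duv , avoid (Σ⊆Class∪dual k duv σ)
    where
      -- r ∉ Class k u v, since by axiom [4] two k-flats always share a line.
      avoid : Class k u v r ⊎ Class (dual k) u v r → ∀ x → Flat (dual k) u v x → ¬ Flat k _ _ x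
      avoid (inj₁ sr) _ _ _ =
        let (x , fx , gx) = Flats-meet k dab duv
        in disjoint x (Flat⊆⟦∣∣⟧ k dab s fx , Flat⊆⟦∣∣⟧ k duv sr gx)
      avoid (inj₂ sr) x gx fx = disjoint x (Flat⊆⟦∣∣⟧ k dab s fx , Flat⊆⟦∣∣⟧ (dual k) duv sr gx)

  dual-Flat⊈Flat : ∀ k {a b c d} → IncDist a b → IncDist c d → ¬ (Flat (dual k) c d ⊆ Flat k a b)
  dual-Flat⊈Flat k dab dcd incl with dual-Flat-avoiding k dab
  ... | u , v , duv , avoid with Flats-meet (dual k) dcd duv
  ... | x , fx , gx = avoid x gx (incl fx)

  -- The labelling of Σ(a,b) is not assumed to be symmetric in a and b.
  Class-swap : ∀ k {a b} → IncDist a b → ∀ {c} → Class k a b c → Class k b a c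
  Class-swap k d s with Σ⊆Class∪dual k (IncDist-sym d) (Σ-swap (Class⊆Σ k d s))
  ... | inj₁ s' = s'
  ... | inj₂ s' = ⊥-elim (dual-Flat⊈Flat k d (IncDist-sym d) incl)
    where
      incl : Flat (dual k) _ _ ⊆ Flat k _ _
      incl fz with Flat⊆⟦∣∣⟧ (dual k) (IncDist-sym d) s' fz
      ... | b∼z , a∼z , c∼z = ⟦∣∣⟧⊆Flat k s (a∼z , b∼z , c∼z)

  Flat-swap : ∀ k {a b} → IncDist a b → ∀ {x} → Flat k a b x → Flat k b a x
  Flat-swap k d (c , s , a∼x , b∼x , c∼x) = c , Class-swap k d s , b∼x , a∼x , c∼x

  Flat⊆Flat : ∀ k k′ {a b x y} → IncDist x y → ∀ {c} → Class k a b c →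
              Flat k′ x y a → Flat k′ x y b → Flat k′ x y c → Flat k′ x y ⊆ Flat k a b
  Flat⊆Flat k k′ dxy s fa fb fc fz =
    ⟦∣∣⟧⊆Flat k s (Flat-clique k′ dxy fa fz , Flat-clique k′ dxy fb fz , Flat-clique k′ dxy fc fz)

  Flat≐Flat : ∀ k k′ {a b x y} → IncDist a b → IncDist x y →
              Flat k a b x → Flat k a b y → ∀ {e} → Class k′ x y e → Flat k a b e →
              Flat k a b ≐ Flat k′ x y
  Flat≐Flat k k′ {a} {b} {x} {y} dab dxy fx fy se fe with Class-nonempty k dab
  ... | _ , s =
    F⊆G ,
    Flat⊆Flat k k′ dxy s (F⊆G (left∈Flat k dab)) (F⊆G (right∈Flat k dab)) (F⊆G (Class⊆Flat k dab s))
    where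
      F⊆G : Flat k a b ⊆ Flat k′ x y
      F⊆G = Flat⊆Flat k′ k dab se fx fy fe

  -- If every line of the flat were central for x, y, then all of [xy] would lie
  -- in it, including the two mutually skew classes of Σ(x,y).
  Flat-spanned : ∀ k {a b x y} → IncDist a b → Flat k a b x → Flat k a b y → IncDist x y →
                 ¬ ¬ (Flat k a b ≐ Flat k x y)
  Flat-spanned k {a} {b} {x} {y} dab fx fy dxy F≉G with Class-nonempty k dab
  ... | _ , s =
    ¬¬central (left∈Flat k dab) λ a-central →
    ¬¬central (right∈Flat k dab) λ b-central →
    ¬¬central (Class⊆Flat k dab s) λ c-central →
    let inF : ⟦ x ∣ y ⟧ ⊆ Flat k a b
        inF h = ⟦∣∣⟧⊆Flat k s (a-central _ h , b-central _ h , c-central _ h)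
        (u , su) = Class-nonempty k dxy
        (v , sv) = Class-nonempty (dual k) dxy
    in Class-skew-dual k dxy su sv
         (Flat-clique k dab (inF (Class-incident k dxy su)) (inF (Class-incident (dual k) dxy sv)))
    where
      ¬¬central : ∀ {e} → Flat k a b e → ¬ ¬ ⟦ x ∣ y ⟧∼ e
      ¬¬central fe ¬central
          with Σ⊆Class∪dual k dxy ((Flat-clique k dab fx fe , Flat-clique k dab fy fe) , ¬central)
      ... | inj₁ se = F≉G (Flat≐Flat k k dab dxy fx fy se fe)
      ... | inj₂ se = dual-Flat⊈Flat k dab dxy (proj₂ (Flat≐Flat k (dual k) dab dxy fx fy se fe))

  Flat∩Flat≡apex : ∀ k {x y z e} → IncDist x y → IncDist x z → Class (dual k) x y z →
                   Flat k x y e → Flat k x z e → ¬ ¬ (e ≡ x)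
  Flat∩Flat≡apex k {x} {e = e} dxy dxz sz fe ge e≢x =
    Flat-spanned k dxy (left∈Flat k dxy) fe dxe λ (_ , E⊆F) →
    Flat-spanned k dxz (left∈Flat k dxz) ge dxe λ (G⊆E , _) →
    dual-Class-∉Flat k dxy sz (E⊆F (G⊆E (right∈Flat k dxz)))
    where
      dxe : IncDist x e
      dxe = Flat-clique k dxy (left∈Flat k dxy) fe , ≢-sym e≢x

  Class-within-Flat : ∀ k {u v x y z} → IncDist u v →
    Flat k u v x → Flat k u v y → Flat k u v z → IncDist x y → ¬ ⟦ x ∣ y ⟧∼ z → Class k x y z
  Class-within-Flat k duv fx fy fz dxy ¬central
      with Σ⊆Class∪dual k dxy ((Flat-clique k duv fx fz , Flat-clique k duv fy fz) , ¬central)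
  ... | inj₁ sz = sz
  ... | inj₂ sz = ⊥-elim (Flat-spanned k duv fx fy dxy λ (F⊆G , _) →
                    ¬central (Flat∩dual⊆central k dxy (F⊆G fz) (Class⊆Flat (dual k) dxy sz)))

  Class-outside-Flat : ∀ k {u v x y z} → IncDist u v →
    Flat k u v x → Flat k u v y → IncDist x y → ⟦ x ∣ y ⟧ z → ¬ Flat k u v z → Class (dual k) x y z
  Class-outside-Flat k duv fx fy dxy h z∉ =
    ∉Flat⇒dual-Class k dxy h λ fz → Flat-spanned k duv fx fy dxy λ (_ , G⊆F) → z∉ (G⊆F fz)

  -- The k-flats (y,z) and (y,x) share only y, and d ≠ y because y ∉ Flat k u v.
  off-Flat : ∀ k {x y z u v d} → IncDist y z → IncDist y x → Class (dual k) y z x →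
             IncDist u v → Class (dual k) u v y → Flat k y x d → Flat k u v d → ¬ Flat k y z d
  off-Flat k dyz dyx x∈ duv y∈ d∈yx d∈uv d∈yz =
    Flat∩Flat≡apex k dyz dyx x∈ d∈yz d∈yx λ d≡y →
    dual-Class-∉Flat k duv y∈ (subst (Flat k _ _) d≡y d∈uv)

  plane-triad-within : ∀ {u v x y z} → IncDist u v → pl u v x → pl u v y → pl u v z →
    x ≢ y → y ≢ z → z ≢ x → ¬ ⟦ x ∣ y ⟧∼ z → ¬ ⟦ y ∣ z ⟧∼ x → ¬ ⟦ z ∣ x ⟧∼ y → PlaneTriad x y z
  plane-triad-within {x = x} {y} {z} duv fx fy fz x≢y y≢z z≢x ¬xy ¬yz ¬zx =
    (dxy , dyz , dzx , (Flat-clique plane duv fx fz , Flat-clique plane duv fy fz) , ¬xy) ,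
    Class-within-Flat plane duv fy fz fx dyz ¬yz ,
    Class-within-Flat plane duv fz fx fy dzx ¬zx ,
    Class-within-Flat plane duv fx fy fz dxy ¬xy
    where
      dxy : IncDist x y
      dxy = Flat-clique plane duv fx fy , x≢y
      dyz : IncDist y z
      dyz = Flat-clique plane duv fy fz , y≢z
      dzx : IncDist z x
      dzx = Flat-clique plane duv fz fx , z≢x

module PointTetrads (S : LinearSpace) where
  open LinearSpace S
  open Flats S

  record PointTetradFacts (o p q r : Line) : Set where
    field
      dop : IncDist o p
      doq : IncDist o q
      dor : IncDist o r
      dpq : IncDist p q
      dqr : IncDist q r
      drp : IncDist r p
      pt-opq : Σpt o p q
      pt-opr : Σpt o p r
      pt-oqp : Σpt o q p
      pt-orp : Σpt o r p
      pt-orq : Σpt o r q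
      pt-pqo : Σpt p q o
      pt-pqr : Σpt p q r
      pt-qro : Σpt q r o
      pt-qrp : Σpt q r p

  point-tetrad-facts : ∀ {o p q r} → PointTetrad o p q r → PointTetradFacts o p q r
  point-tetrad-facts
    (_ , _ , _ , _ , _ , _ , ((dpq , dqr , drp , _) , sqrp , _ , spqr) ,
     ((doq , _ , dro , _) , sqro , sroq , _) , ((dor , _ , dpo , _) , _ , spor , sorp) ,
     ((dop , _ , dqo , _) , spqo , sqop , sopq)) = record
    { dop = dop ; doq = doq ; dor = dor ; dpq = dpq ; dqr = dqr ; drp = drp
    ; pt-opq = sopq ; pt-opr = Class-swap point dpo spor ; pt-oqp = Class-swap point dqo sqop
    ; pt-orp = sorp ; pt-orq = Class-swap point dro sroq ; pt-pqo = spqo ; pt-pqr = spqr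
    ; pt-qro = sqro ; pt-qrp = sqrp }

  rotate : ∀ {o p q r} → PointTetrad o p q r → PointTetrad o q r p
  rotate (iop , ioq , ior , ipq , ipr , iqr ,
          ((dpq , dqr , drp , _) , sqrp , srpq , spqr) , t₂ , t₃ , t₄) =
    ioq , ior , iop , iqr , ∼-sym ipq , ∼-sym ipr ,
    ((dqr , drp , dpq , Class⊆Σ point dqr sqrp) , srpq , spqr , sqrp) , t₃ , t₄ , t₂

  record Diagonals (o p q r a b c : Line) : Set where
    constructor diagonals
    field
      a∈op : pl o p a
      a∈qr : pl q r a
      b∈oq : pl o q b
      b∈rp : pl r p b
      c∈or : pl o r c
      c∈pq : pl p q c

  module DiagonalPair (hpl : Hpl) {o p q r a b c : Line}
                      (T : PointTetradFacts o p q r) (D : Diagonals o p q r a b c) where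
    open PointTetradFacts T
    open Diagonals D

    P : Line → Set
    P = pt o p

    in-P : ∀ {w} → o ∼ w → p ∼ w → q ∼ w → P w
    in-P o∼w p∼w q∼w = ⟦∣∣⟧⊆Flat point pt-opq (o∼w , p∼w , q∼w)

    o∈P : P o
    o∈P = left∈Flat point dop
    p∈P : P p
    p∈P = right∈Flat point dop
    q∈P : P q
    q∈P = Class⊆Flat point dop pt-opq
    r∈P : P r
    r∈P = in-P (proj₁ dor) (∼-sym (proj₁ drp)) (proj₁ dqr)
    a∈P : P a
    a∈P = in-P (Flat⇒left∼ plane a∈op) (Flat⇒right∼ plane a∈op) (Flat⇒left∼ plane a∈qr)
    b∈P : P b
    b∈P = in-P (Flat⇒left∼ plane b∈oq) (Flat⇒right∼ plane b∈rp) (Flat⇒right∼ plane b∈oq)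
    c∈P : P c
    c∈P = in-P (Flat⇒left∼ plane c∈or) (Flat⇒left∼ plane c∈pq) (Flat⇒right∼ plane c∈pq)

    P-clique : ∀ {x y} → P x → P y → x ∼ y
    P-clique = Flat-clique point dop

    a∉oq : ¬ pl o q a
    a∉oq = off-Flat plane doq dop pt-oqp dqr pt-qro a∈op a∈qr
    a∉or : ¬ pl o r a
    a∉or = off-Flat plane dor dop pt-orp dqr pt-qro a∈op a∈qr
    a∉pq : ¬ pl p q a
    a∉pq = off-Flat plane dpq (IncDist-sym dop) pt-pqo dqr pt-qrp (Flat-swap plane dop a∈op) a∈qr
    c∉op : ¬ pl o p c
    c∉op = off-Flat plane dop dor pt-opr dpq pt-pqo c∈or c∈pq
    c∉qr : ¬ pl q r c
    c∉qr = off-Flat plane dqr (IncDist-sym dpq) pt-qrp dor pt-orq (Flat-swap plane dpq c∈pq) c∈or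

    dab : IncDist a b
    dab = P-clique a∈P b∈P , λ a≡b → a∉oq (subst (pl o q) (sym a≡b) b∈oq)

    module Section {u v} (duv : IncDist u v) (Π∩P=∅ : ∀ x → pl u v x → ¬ P x)
                   (c-central : ⟦ a ∣ b ⟧∼ c) where
      section : ∀ {x y} → IncDist x y → Line
      section dxy = proj₁ (Flats-meet plane dxy duv)

      section∈pl : ∀ {x y} (dxy : IncDist x y) → pl x y (section dxy)
      section∈pl dxy = proj₁ (proj₂ (Flats-meet plane dxy duv))

      section∈Π : ∀ {x y} (dxy : IncDist x y) → pl u v (section dxy)
      section∈Π dxy = proj₂ (proj₂ (Flats-meet plane dxy duv))

      Π-clique : ∀ {x y} → pl u v x → pl u v y → x ∼ y
      Π-clique = Flat-clique plane duv

      section∼ : ∀ {x y w} (dxy : IncDist x y) → pl x y w → section dxy ∼ w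
      section∼ dxy = Flat-clique plane dxy (section∈pl dxy)

      section∈Σpl : ∀ {x y} (dxy : IncDist x y) → P x → P y → Σpl x y (section dxy)
      section∈Σpl dxy x∈P y∈P =
        Class-outside-Flat point dop x∈P y∈P dxy
          (Flat⇒left∼ plane (section∈pl dxy) , Flat⇒right∼ plane (section∈pl dxy))
          (Π∩P=∅ _ (section∈Π dxy))

      section≁vertex : ∀ {x y z} (dxy : IncDist x y) → P x → P y → Σpt x y z → Skew (section dxy) z
      section≁vertex dxy x∈P y∈P z∈ = Class-skew-dual plane dxy (section∈Σpl dxy x∈P y∈P) z∈

      section≁diagonal : ∀ {x y z} (dxy : IncDist x y) → P x → P y → P z → ¬ pl x y z →
                         Skew (section dxy) z
      section≁diagonal dxy x∈P y∈P z∈P z∉ l∼z =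
        z∉ (⟦∣∣⟧⊆Flat plane (section∈Σpl dxy x∈P y∈P) (P-clique x∈P z∈P , P-clique y∈P z∈P , l∼z))

      lop lpq lqr lor lrp loq lab : Line
      lop = section dop
      lpq = section dpq
      lqr = section dqr
      lor = section dor
      lrp = section drp
      loq = section doq
      lab = section dab

      Πop : pl u v lop
      Πop = section∈Π dop
      Πpq : pl u v lpq
      Πpq = section∈Π dpq
      Πqr : pl u v lqr
      Πqr = section∈Π dqr
      Πor : pl u v lor
      Πor = section∈Π dor
      Πrp : pl u v lrp
      Πrp = section∈Π drp
      Πoq : pl u v loq
      Πoq = section∈Π doq
      Πab : pl u v lab
      Πab = section∈Π dab

      lop∼o : lop ∼ o
      lop∼o = section∼ dop (left∈Flat plane dop)
      lop∼p : lop ∼ p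
      lop∼p = section∼ dop (right∈Flat plane dop)
      lop∼a : lop ∼ a
      lop∼a = section∼ dop a∈op
      lpq∼p : lpq ∼ p
      lpq∼p = section∼ dpq (left∈Flat plane dpq)
      lpq∼q : lpq ∼ q
      lpq∼q = section∼ dpq (right∈Flat plane dpq)
      lpq∼c : lpq ∼ c
      lpq∼c = section∼ dpq c∈pq
      lqr∼q : lqr ∼ q
      lqr∼q = section∼ dqr (left∈Flat plane dqr)
      lqr∼r : lqr ∼ r
      lqr∼r = section∼ dqr (right∈Flat plane dqr)
      lqr∼a : lqr ∼ a
      lqr∼a = section∼ dqr a∈qr
      lor∼o : lor ∼ o
      lor∼o = section∼ dor (left∈Flat plane dor)
      lor∼r : lor ∼ r
      lor∼r = section∼ dor (right∈Flat plane dor)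
      lor∼c : lor ∼ c
      lor∼c = section∼ dor c∈or

      lop≁q : Skew lop q
      lop≁q = section≁vertex dop o∈P p∈P pt-opq
      lop≁r : Skew lop r
      lop≁r = section≁vertex dop o∈P p∈P pt-opr
      lpq≁o : Skew lpq o
      lpq≁o = section≁vertex dpq p∈P q∈P pt-pqo
      lpq≁r : Skew lpq r
      lpq≁r = section≁vertex dpq p∈P q∈P pt-pqr
      lqr≁o : Skew lqr o
      lqr≁o = section≁vertex dqr q∈P r∈P pt-qro
      lqr≁p : Skew lqr p
      lqr≁p = section≁vertex dqr q∈P r∈P pt-qrp
      lor≁p : Skew lor p
      lor≁p = section≁vertex dor o∈P r∈P pt-orp
      lor≁q : Skew lor q
      lor≁q = section≁vertex dor o∈P r∈P pt-orq
      lop≁c : Skew lop c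
      lop≁c = section≁diagonal dop o∈P p∈P c∈P c∉op
      lpq≁a : Skew lpq a
      lpq≁a = section≁diagonal dpq p∈P q∈P a∈P a∉pq
      lqr≁c : Skew lqr c
      lqr≁c = section≁diagonal dqr q∈P r∈P c∈P c∉qr
      lor≁a : Skew lor a
      lor≁a = section≁diagonal dor o∈P r∈P a∈P a∉or

      lop≢lpq : lop ≢ lpq
      lop≢lpq = ≢-of-skew lop∼o lpq≁o
      lop≢lqr : lop ≢ lqr
      lop≢lqr = ≢-of-skew lop∼o lqr≁o
      lop≢lor : lop ≢ lor
      lop≢lor = ≢-of-skew lop∼p lor≁p
      lpq≢lqr : lpq ≢ lqr
      lpq≢lqr = ≢-of-skew lpq∼p lqr≁p
      lpq≢lor : lpq ≢ lor
      lpq≢lor = ≢-of-skew lpq∼q lor≁q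
      lqr≢lor : lqr ≢ lor
      lqr≢lor = ≢-of-skew lqr∼q lor≁q

      section-tetrad : PlaneTetrad lop lpq lqr lor
      section-tetrad =
        Π-clique Πop Πpq , Π-clique Πop Πqr , Π-clique Πop Πor ,
        Π-clique Πpq Πqr , Π-clique Πpq Πor , Π-clique Πqr Πor ,
        plane-triad-within duv Πpq Πqr Πor lpq≢lqr lqr≢lor (≢-sym lpq≢lor)
          (¬central-of-skew lpq∼q lqr∼q lor≁q) (¬central-of-skew lqr∼r lor∼r lpq≁r)
          (¬central-of-skew lor∼c lpq∼c lqr≁c) ,
        plane-triad-within duv Πop Πqr Πor lop≢lqr lqr≢lor (≢-sym lop≢lor)
          (¬central-of-skew lop∼a lqr∼a lor≁a) (¬central-of-skew lqr∼r lor∼r lop≁r)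
          (¬central-of-skew lor∼o lop∼o lqr≁o) ,
        plane-triad-within duv Πop Πor Πpq lop≢lor (≢-sym lpq≢lor) (≢-sym lop≢lpq)
          (¬central-of-skew lop∼o lor∼o lpq≁o) (¬central-of-skew lor∼c lpq∼c lop≁c)
          (¬central-of-skew lpq∼p lop∼p lor≁p) ,
        plane-triad-within duv Πop Πpq Πqr lop≢lpq lpq≢lqr (≢-sym lop≢lqr)
          (¬central-of-skew lop∼p lpq∼p lqr≁p) (¬central-of-skew lpq∼q lqr∼q lop≁q)
          (¬central-of-skew lqr∼a lop∼a lpq≁a)

      trace∈pt : ∀ {x y z w} → pl u v x → pl u v y → x ≢ y → P z → x ∼ z → y ∼ z →
                 pl u v w → z ∼ w → pt x y w
      trace∈pt Πx Πy x≢y z∈P x∼z y∼z Πw z∼w =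
        _ , Class-outside-Flat plane duv Πx Πy (Π-clique Πx Πy , x≢y) (x∼z , y∼z)
              (λ Πz → Π∩P=∅ _ Πz z∈P) ,
        Π-clique Πx Πw , Π-clique Πy Πw , z∼w

      diagonal-triad : PlaneTriad lrp lab loq
      diagonal-triad = hpl lop lpq lqr lor section-tetrad lrp lab loq
        (trace∈pt Πop Πpq lop≢lpq p∈P lop∼p lpq∼p Πrp (Flat⇒right∼ plane (section∈pl drp)))
        (trace∈pt Πqr Πor lqr≢lor r∈P lqr∼r lor∼r Πrp (Flat⇒left∼ plane (section∈pl drp)))
        (trace∈pt Πop Πqr lop≢lqr a∈P lop∼a lqr∼a Πab a∼lab)
        (trace∈pt Πor Πpq (≢-sym lpq≢lor) c∈P lor∼c lpq∼c Πab (c-central lab (a∼lab , b∼lab)))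
        (trace∈pt Πop Πor lop≢lor o∈P lop∼o lor∼o Πoq (Flat⇒left∼ plane (section∈pl doq)))
        (trace∈pt Πpq Πqr lpq≢lqr q∈P lpq∼q lqr∼q Πoq (Flat⇒right∼ plane (section∈pl doq)))
        where
          a∼lab : a ∼ lab
          a∼lab = Flat⇒left∼ plane (section∈pl dab)
          b∼lab : b ∼ lab
          b∼lab = Flat⇒right∼ plane (section∈pl dab)

      contradiction : ⊥
      contradiction = Class-skew-dual point dlrp-lab b∈Σpt loq∈Σpl (∼-sym (section∼ doq b∈oq))
        where
          dlrp-lab : IncDist lrp lab
          dlrp-lab = proj₁ (proj₁ diagonal-triad)
          loq∈Σpl : Σpl lrp lab loq
          loq∈Σpl = proj₂ (proj₂ (proj₂ diagonal-triad))
          b∈Σpt : Σpt lrp lab b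
          b∈Σpt = Class-outside-Flat plane duv Πrp Πab dlrp-lab
                    (section∼ drp b∈rp , section∼ dab (right∈Flat plane dab))
                    (λ Πb → Π∩P=∅ _ Πb b∈P)

    c-not-central : ¬ ⟦ a ∣ b ⟧∼ c
    c-not-central c-central with dual-Flat-avoiding point dop
    ... | u , v , duv , Π∩P=∅ = Section.contradiction duv Π∩P=∅ c-central

    c∈Σpt : Σpt a b c
    c∈Σpt = Class-within-Flat point dop a∈P b∈P c∈P dab c-not-central

theorem3 : (S : LinearSpace) → LinearSpace.Hpl S → LinearSpace.Hpt S
theorem3 S hpl o p q r T a b c a∈op a∈qr b∈oq b∈rp c∈or c∈pq =
  (A.dab , B.dab , C.dab , Class⊆Σ point A.dab A.c∈Σpt) , B.c∈Σpt , C.c∈Σpt , A.c∈Σpt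
  where
    open Flats S
    open PointTetrads S
    module A = DiagonalPair hpl (point-tetrad-facts T)
                 (diagonals a∈op a∈qr b∈oq b∈rp c∈or c∈pq)
    module B = DiagonalPair hpl (point-tetrad-facts (rotate T))
                 (diagonals b∈oq b∈rp c∈or c∈pq a∈op a∈qr)
    module C = DiagonalPair hpl (point-tetrad-facts (rotate (rotate T)))
                 (diagonals c∈or c∈pq a∈op a∈qr b∈oq b∈rp)
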